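{- Let $G$ be a finite abelian group, written multiplicatively, with identity $e$ and exponent $N$, and let $S\subseteq G\setminus\{e\}$. Let $C_N$ be the group of complex $N$-th roots of unity. Define $\phi$ on the arcs of the Cayley digraph $\mathrm{Cay}(G;S)$ by $\phi((g,gs))=\exp\!\left(\frac{2\pi i}{\mathrm{ord}(s)}\right)\in C_N$. Then $S$ is weakly half factorial if and only if the voltage digraph $(\mathrm{Cay}(G;S),\phi,C_N)$ satisfies Kirchhoff's Voltage Law.
   Context: Blocks and atoms: a finite sequence (multiset) $\{g_1,\dots,g_k\}$ of non-identity elements of $G$ is a block if $\prod_{i=1}^k g_i=e$. It is an atom if, whenever $\prod_{i=1}^k g_i^{m_i}=e$ with all $m_i\in\{0,1\}$, either all $m_i=1$ or all $m_i=0$. An atom has support in $S$ if all its $g_i$ lie in $S$. Cross number: the cross number of $\beta=\{g_1,\dots,g_k\}$ is $c(\beta)=\sum_{i=1}^k 1/\mathrm{ord}(g_i)$, where $\mathrm{ord}(g)$ is the order of $g$ in $G$ and elements are counted with multiplicity. Weakly half factorial (property $(C_0)$): $S$ is weakly half factorial if every atom with support in $S$ has an integer cross number. Cayley digraph: $\mathrm{Cay}(G;S)$ has vertex set $G$ and arc set $\{(g,gs): g\in G,\ s\in S\}$. Paths: a walk is a sequence of arcs $a_1\cdots a_k$ with $k\ge 1$ such that the end vertex of $a_i$ is the start vertex of $a_{i+1}$. A path is a walk whose vertices $x_1,\dots,x_{k+1}$ are distinct, except that $x_1=x_{k+1}$ is allowed. A closed path is a path with $x_1=x_{k+1}$. Kirchhoff's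 Voltage Law: the voltage digraph satisfies Kirchhoff's Voltage Law if every closed path $a_1a_2\cdots a_k$ satisfies $\prod_{i=1}^k\phi(a_i)=1$. -}

module Defs where

open import Level using (Level; _⊔_)
open import Algebra.Bundles using (AbelianGroup)
open import Data.Nat as ℕ using (ℕ; zero; suc; _<_; _∸_)
open import Data.Nat.Divisibility using (_∣_)
open import Data.Nat.LCM using (lcm)
open import Data.Bool using (Bool; true; false)
open import Data.List as List using (List; length)
open import Data.List.Relation.Unary.Any using (Any)
open import Data.Vec as Vec using (Vec; []; _∷_; lookup; head; last)
open import Data.Vec.Relation.Unary.All as VAll using ()
open import Data.Fin using (Fin; toℕ)
open import Data.Integer as ℤ using (ℤ)
open import Data.Rational as ℚ using (ℚ; 0ℚ)
open import Data.Product using (Σ; ∃; _×_)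
open import Relation.Nullary using (¬_; yes; no)
open import Relation.Binary using (Decidable)
open import Relation.Binary.PropositionalEquality using (_≡_)
open import Relation.Unary using (Pred)

record FiniteAbelianGroup (c ℓ : Level) : Set (Level.suc (c ⊔ ℓ)) where
  field
    abelianGroup : AbelianGroup c ℓ
  open AbelianGroup abelianGroup public
  field
    _≟_      : Decidable _≈_
    enum     : List Carrier
    complete : ∀ x → Any (x ≈_) enum

module _ {c ℓ : Level} (G : FiniteAbelianGroup c ℓ) where
  open FiniteAbelianGroup G

  pow : Carrier → ℕ → Carrier
  pow g zero    = ε
  pow g (suc n) = g ∙ pow g n

  -- ord g : the least m ≥ 1 with g^m ≈ e.  It is found by a bounded search
  -- over m = 1, 2, …, (length enum + 1); since ord g ≤ |G| ≤ length enum the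
  -- search always succeeds (the fallback value is never reached).
  -- ordSearch g fuel i returns the predecessor of the order, starting at m = suc i.
  ordSearch : Carrier → ℕ → ℕ → ℕ
  ordSearch g fuel i with pow g (suc i) ≟ ε
  ... | yes _ = i
  ordSearch g zero       i | no _ = i
  ordSearch g (suc fuel) i | no _ = ordSearch g fuel (suc i)

  ord : Carrier → ℕ
  ord g = suc (ordSearch g (length enum) 0)

  exponent : ℕ
  exponent = List.foldr lcm 1 (List.map ord enum)

  prod : ∀ {k} → Vec Carrier k → Carrier
  prod = Vec.foldr _ _∙_ ε

  prodSel : ∀ {k} → Vec Carrier k → Vec Bool k → Carrier
  prodSel []       []           = ε
  prodSel (g ∷ gs) (true  ∷ ms) = g ∙ prodSel gs ms
  prodSel (g ∷ gs) (false ∷ ms) = prodSel gs ms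

  allOnes : ∀ {k} → Vec Bool k → Set
  allOnes ms = VAll.All (_≡ true) ms

  allZeros : ∀ {k} → Vec Bool k → Set
  allZeros ms = VAll.All (_≡ false) ms

  IsBlock : ∀ {k} → Vec Carrier k → Set (c ⊔ ℓ)
  IsBlock gs = VAll.All (λ g → ¬ (g ≈ ε)) gs × prod gs ≈ ε

  IsAtom : ∀ {k} → Vec Carrier k → Set (c ⊔ ℓ)
  IsAtom {k} gs = IsBlock gs ×
    ((ms : Vec Bool k) → prodSel gs ms ≈ ε → allOnes ms Data.Sum.⊎ allZeros ms)
    where import Data.Sum

  crossNumber : ∀ {k} → Vec Carrier k → ℚ
  crossNumber = Vec.foldr _ (λ g r → (ℤ.+ 1 ℚ./ ord g) ℚ.+ r) 0ℚ

  IsIntegerℚ : ℚ → Set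
  IsIntegerℚ q = ∃ λ (z : ℤ) → q ≡ (z ℚ./ 1)

  WeaklyHalfFactorial : ∀ {p} → Pred Carrier p → Set (c ⊔ ℓ ⊔ p)
  WeaklyHalfFactorial S =
    ∀ {k} (β : Vec Carrier k) → VAll.All S β → IsAtom β → IsIntegerℚ (crossNumber β)

  -- Walks in Cay(G;S): a start vertex x₁ and a sequence of generators
  -- s₁ … s_k ∈ S; the arcs are (x_i , x_i s_i) and the vertices are
  -- x₁ , x₂ = x₁ s₁ , … , x_{k+1} = x_k s_k.
  vertices : ∀ {k} → Carrier → Vec Carrier k → Vec Carrier (suc k)
  vertices x []       = x ∷ []
  vertices x (s ∷ ss) = x ∷ vertices (x ∙ s) ss

  -- closed path of length k+1 ≥ 1: vertices distinct except x₁ = x_{k+2}, and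
  -- x₁ ≈ x_{k+2}
  IsClosedPath : ∀ {k} → Carrier → Vec Carrier (suc k) → Set ℓ
  IsClosedPath {k} x ss =
    (∀ (i j : Fin (suc (suc k))) → toℕ i < toℕ j →
       ¬ (toℕ i ≡ 0 × toℕ j ≡ suc k) →
       ¬ (lookup (vertices x ss) i ≈ lookup (vertices x ss) j))
    × (head (vertices x ss) ≈ last (vertices x ss))

  -- The cyclic group C_N of complex N-th roots of unity (N = exponent) is
  -- represented by exponents: a natural number a stands for exp(2πi·a/N).
  -- Multiplication is addition of exponents, and exp(2πi·a/N) = 1 iff N ∣ a.
  IsOneInC : ℕ → Set
  IsOneInC a = exponent ∣ a

  -- φ((g, g s)) = exp(2πi/ord(s)) = exp(2πi·(N/ord(s))/N)
  φ : Carrier → ℕ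
  φ s = exponent ℕ./ ord s

  voltageProduct : ∀ {k} → Vec Carrier k → ℕ
  voltageProduct = Vec.foldr _ (λ s a → φ s ℕ.+ a) 0

  KVL : ∀ {p} → Pred Carrier p → Set (c ⊔ ℓ ⊔ p)
  KVL S = ∀ {k} (x : Carrier) (ss : Vec Carrier (suc k)) → VAll.All S ss →
    IsClosedPath x ss → IsOneInC (voltageProduct ss)

-- Since 1/ord(s) = φ(s)/N, the cross number of a sequence is its total voltage divided by N,
-- so integrality of the cross number is divisibility of the voltage by N.  Walking along a sequence
-- s₁ … s_k from a vertex x visits x s₁ ⋯ s_i, and two visits coincide exactly when a contiguous
-- segment multiplies to e.  Hence the generators of a closed path form a block (which splits into
-- atoms, and voltage is additive), while an atom, having no proper zero-sum segment, traces a closed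
-- path from e.
module Submission where

open import Defs
open import Relation.Unary using (Pred; Decidable)
open import Relation.Nullary using (¬_; yes; no)
open import Relation.Nullary.Decidable using (_×-dec_; ¬?)
open import Function.Bundles using (_⇔_; mk⇔; Equivalence)
open import Data.Nat as ℕ using (ℕ; zero; suc; _≤_; _<_; z≤n; s≤s; NonZero)
import Data.Nat.Properties as ℕP
import Algebra.Properties.CommutativeSemigroup ℕP.+-commutativeSemigroup as ℕ+
open import Data.Nat.Divisibility using (_∣_; divides; _∣0; 0∣⇒≡0; ∣m∣n⇒∣m+n; ∣-trans; ∣-reflexive; m∣m*n; n∣m*n)
open import Data.Nat.DivMod using (m/n*n≡m)
open import Data.Nat.LCM using (lcm; m∣lcm[m,n]; n∣lcm[m,n]; lcm-least)
open import Data.Nat.Induction using (<-rec)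
open import Data.Bool as Bool using (Bool; true; false)
open import Data.Vec using (Vec; []; _∷_; lookup; last)
open import Data.Vec.Relation.Unary.All as All using (All; []; _∷_)
open import Data.Fin as Fin using (Fin; toℕ)
import Data.Fin.Properties as FinP
open import Data.Fin.Subset.Properties using (anySubset?)
open import Data.List as List using (List)
open import Data.List.Relation.Unary.Any using (Any; here; there)
open import Data.Product using (∃; _×_; _,_; proj₂)
open import Data.Sum using (_⊎_; inj₁; inj₂)
open import Data.Empty using (⊥-elim)
open import Relation.Binary.PropositionalEquality as ≡ using (_≡_; refl; cong)
import Relation.Binary.Reasoning.Setoid as ≈-Reasoning
open import Data.Integer as ℤ using (+_)
import Data.Integer.Properties as ℤP
open import Data.Integer.Tactic.RingSolver using (solve-∀)
open import Data.Rational as ℚ using (ℚ; toℚᵘ)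
import Data.Rational.Properties as ℚP
open import Data.Rational.Unnormalised as ℚᵘ using (mkℚᵘ; *≡*; _≃_)
import Data.Rational.Unnormalised.Properties as ℚᵘP

countTrue : ∀ {k} → Vec Bool k → ℕ
countTrue []           = 0
countTrue (true  ∷ ms) = suc (countTrue ms)
countTrue (false ∷ ms) = countTrue ms

countFalse : ∀ {k} → Vec Bool k → ℕ
countFalse []           = 0
countFalse (true  ∷ ms) = countFalse ms
countFalse (false ∷ ms) = suc (countFalse ms)

countTrue≤ : ∀ {k} (ms : Vec Bool k) → countTrue ms ≤ k
countTrue≤ []           = z≤n
countTrue≤ (true  ∷ ms) = s≤s (countTrue≤ ms)
countTrue≤ (false ∷ ms) = ℕP.m≤n⇒m≤1+n (countTrue≤ ms)

countFalse≤ : ∀ {k} (ms : Vec Bool k) → countFalse ms ≤ k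
countFalse≤ []           = z≤n
countFalse≤ (true  ∷ ms) = ℕP.m≤n⇒m≤1+n (countFalse≤ ms)
countFalse≤ (false ∷ ms) = s≤s (countFalse≤ ms)

countTrue< : ∀ {k} (ms : Vec Bool k) → ¬ All (_≡ true) ms → countTrue ms < k
countTrue< []           notAll = ⊥-elim (notAll [])
countTrue< (true  ∷ ms) notAll = s≤s (countTrue< ms (λ all → notAll (refl ∷ all)))
countTrue< (false ∷ ms) _      = s≤s (countTrue≤ ms)

countFalse< : ∀ {k} (ms : Vec Bool k) → ¬ All (_≡ false) ms → countFalse ms < k
countFalse< []           notAll = ⊥-elim (notAll [])
countFalse< (true  ∷ ms) _      = s≤s (countFalse≤ ms)
countFalse< (false ∷ ms) notAll = s≤s (countFalse< ms (λ all → notAll (refl ∷ all)))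

module _ {a} {A : Set a} where

  select : ∀ {k} → Vec A k → (ms : Vec Bool k) → Vec A (countTrue ms)
  select []       []           = []
  select (x ∷ xs) (true  ∷ ms) = x ∷ select xs ms
  select (x ∷ xs) (false ∷ ms) = select xs ms

  reject : ∀ {k} → Vec A k → (ms : Vec Bool k) → Vec A (countFalse ms)
  reject []       []           = []
  reject (x ∷ xs) (true  ∷ ms) = reject xs ms
  reject (x ∷ xs) (false ∷ ms) = x ∷ reject xs ms

  All-select : ∀ {q} {Q : Pred A q} {k} {xs : Vec A k} ms → All Q xs → All Q (select xs ms)
  All-select []           []       = []
  All-select (true  ∷ ms) (q ∷ qs) = q ∷ All-select ms qs
  All-select (false ∷ ms) (q ∷ qs) = All-select ms qs

  All-reject : ∀ {q} {Q : Pred A q} {k} {xs : Vec A k} ms → All Q xs → All Q (reject xs ms)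
  All-reject []           []       = []
  All-reject (true  ∷ ms) (q ∷ qs) = All-reject ms qs
  All-reject (false ∷ ms) (q ∷ qs) = q ∷ All-reject ms qs

-- segment k i j marks the positions p with i ≤ p < j.
segment : ∀ k → ℕ → ℕ → Vec Bool k
segment zero    _       _       = []
segment (suc k) zero    zero    = false ∷ segment k 0 0
segment (suc k) zero    (suc j) = true ∷ segment k 0 j
segment (suc k) (suc i) j       = false ∷ segment k i (ℕ.pred j)

segment-allTrue : ∀ k i j → All (_≡ true) (segment (suc k) i j) → i ≡ 0 × k < j
segment-allTrue zero    zero    (suc j) _          = refl , s≤s z≤n
segment-allTrue (suc k) zero    (suc j) (_ ∷ trues) = refl , s≤s (proj₂ (segment-allTrue k 0 j trues))
segment-allTrue _       zero    zero    (() ∷ _)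
segment-allTrue _       (suc i) _       (() ∷ _)

segment-notAllFalse : ∀ k i j → i < j → j ≤ k → ¬ All (_≡ false) (segment k i j)
segment-notAllFalse (suc k) zero    (suc j) _         _         (() ∷ _)
segment-notAllFalse (suc k) (suc i) (suc j) (s≤s i<j) (s≤s j≤k) (_ ∷ falses) =
  segment-notAllFalse k i j i<j j≤k falses

unitFraction+≃ : ∀ φ v b n → φ ℕ.* suc b ≡ suc n →
                 mkℚᵘ (+ 1) b ℚᵘ.+ mkℚᵘ (+ v) n ≃ mkℚᵘ (+ (φ ℕ.+ v)) n
unitFraction+≃ φ v b n φb≡N = *≡* (begin
  (+ 1 ℤ.* N ℤ.+ V ℤ.* B) ℤ.* N                 ≡⟨ cong (λ m → (+ 1 ℤ.* m ℤ.+ V ℤ.* B) ℤ.* m) FB≡N ⟨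
  (+ 1 ℤ.* (F ℤ.* B) ℤ.+ V ℤ.* B) ℤ.* (F ℤ.* B) ≡⟨ identity F V B ⟩
  (F ℤ.+ V) ℤ.* (B ℤ.* (F ℤ.* B))               ≡⟨ cong (λ m → (F ℤ.+ V) ℤ.* (B ℤ.* m)) FB≡N ⟩
  (F ℤ.+ V) ℤ.* (B ℤ.* N)                       ≡⟨ cong ((F ℤ.+ V) ℤ.*_) (ℤP.pos-* (suc b) (suc n)) ⟨
  + (φ ℕ.+ v) ℤ.* + (suc b ℕ.* suc n)           ∎)
  where
  open ≡.≡-Reasoning
  F = + φ
  V = + v
  B = + suc b
  N = + suc n
  FB≡N : F ℤ.* B ≡ N
  FB≡N = ≡.trans (≡.sym (ℤP.pos-* φ (suc b))) (cong +_ φb≡N)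
  identity : ∀ F V B → (+ 1 ℤ.* (F ℤ.* B) ℤ.+ V ℤ.* B) ℤ.* (F ℤ.* B) ≡ (F ℤ.+ V) ℤ.* (B ℤ.* (F ℤ.* B))
  identity = solve-∀

integer⇔∣ : ∀ (q : ℚ) v n → toℚᵘ q ≃ mkℚᵘ (+ v) n → (∃ λ z → q ≡ z ℚ./ 1) ⇔ suc n ∣ v
integer⇔∣ q v n q≃v/N = mk⇔ to from
  where
  to : (∃ λ z → q ≡ z ℚ./ 1) → suc n ∣ v
  to (z , q≡z) with ℚᵘP.≃-trans (ℚᵘP.≃-sym q≃v/N) (ℚᵘP.≃-trans (ℚP.toℚᵘ-cong q≡z) (ℚP.toℚᵘ-fromℚᵘ (mkℚᵘ z 0)))
  ... | *≡* v≡zN = divides ℤ.∣ z ∣ (begin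
    v                      ≡⟨ cong ℤ.∣_∣ (ℤP.*-identityʳ (+ v)) ⟨
    ℤ.∣ + v ℤ.* + 1 ∣      ≡⟨ cong ℤ.∣_∣ v≡zN ⟩
    ℤ.∣ z ℤ.* + suc n ∣    ≡⟨ ℤP.abs-* z (+ suc n) ⟩
    ℤ.∣ z ∣ ℕ.* suc n      ∎)
    where open ≡.≡-Reasoning
  from : suc n ∣ v → ∃ λ z → q ≡ z ℚ./ 1
  from (divides m v≡mN) = + m , ℚP.toℚᵘ-injective
    (ℚᵘP.≃-trans q≃v/N (ℚᵘP.≃-trans (*≡* v≡mN′) (ℚᵘP.≃-sym (ℚP.toℚᵘ-fromℚᵘ (mkℚᵘ (+ m) 0)))))
    where
    v≡mN′ : + v ℤ.* + 1 ≡ + m ℤ.* + suc n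
    v≡mN′ = ≡.trans (ℤP.*-identityʳ (+ v)) (≡.trans (cong +_ v≡mN) (ℤP.pos-* m (suc n)))

lcm-nonZero : ∀ m n .{{_ : NonZero m}} .{{_ : NonZero n}} → NonZero (lcm m n)
lcm-nonZero m n = ℕ.≢-nonZero λ lcm≡0 →
  ℕ.≢-nonZero⁻¹ (m ℕ.* n) {{ℕP.m*n≢0 m n}}
    (0∣⇒≡0 (≡.subst (_∣ m ℕ.* n) lcm≡0 (lcm-least (m∣m*n {m} n) (n∣m*n m {n}))))

module _ {c ℓ} (G : FiniteAbelianGroup c ℓ) where
  open FiniteAbelianGroup G renaming (refl to ≈-refl)
  open import Algebra.Properties.Group group using (identityʳ-unique)
  open import Algebra.Properties.CommutativeSemigroup commutativeSemigroup using (x∙yz≈y∙xz)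

  pow-cong : ∀ {g h} → g ≈ h → ∀ n → pow G g n ≈ pow G h n
  pow-cong g≈h zero    = ≈-refl
  pow-cong g≈h (suc n) = ∙-cong g≈h (pow-cong g≈h n)

  ordSearch-cong : ∀ {g h} → g ≈ h → ∀ fuel i → ordSearch G g fuel i ≡ ordSearch G h fuel i
  ordSearch-cong {g} {h} g≈h fuel i with pow G g (suc i) ≟ ε | pow G h (suc i) ≟ ε
  ... | yes _    | yes _    = refl
  ... | yes gⁱ≈ε | no  hⁱ≉ε = ⊥-elim (hⁱ≉ε (trans (sym (pow-cong g≈h (suc i))) gⁱ≈ε))
  ... | no  gⁱ≉ε | yes hⁱ≈ε = ⊥-elim (gⁱ≉ε (trans (pow-cong g≈h (suc i)) hⁱ≈ε))
  ordSearch-cong g≈h zero       i | no _ | no _ = refl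
  ordSearch-cong g≈h (suc fuel) i | no _ | no _ = ordSearch-cong g≈h fuel (suc i)

  ord-cong : ∀ {g h} → g ≈ h → ord G g ≡ ord G h
  ord-cong g≈h = cong suc (ordSearch-cong g≈h _ 0)

  lcmOfOrders : List Carrier → ℕ
  lcmOfOrders xs = List.foldr lcm 1 (List.map (ord G) xs)

  ord∣lcmOfOrders : ∀ {g} xs → Any (g ≈_) xs → ord G g ∣ lcmOfOrders xs
  ord∣lcmOfOrders (x List.∷ xs) (here g≈x)   =
    ∣-trans (∣-reflexive (ord-cong g≈x)) (m∣lcm[m,n] (ord G x) (lcmOfOrders xs))
  ord∣lcmOfOrders (x List.∷ xs) (there g∈xs) =
    ∣-trans (ord∣lcmOfOrders xs g∈xs) (n∣lcm[m,n] (ord G x) (lcmOfOrders xs))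

  lcmOfOrders-nonZero : ∀ xs → NonZero (lcmOfOrders xs)
  lcmOfOrders-nonZero List.[]       = _
  lcmOfOrders-nonZero (x List.∷ xs) = lcm-nonZero (ord G x) _ {{_}} {{lcmOfOrders-nonZero xs}}

  ord∣exponent : ∀ g → ord G g ∣ exponent G
  ord∣exponent g = ord∣lcmOfOrders enum (complete g)

  exponent-1 : ℕ
  exponent-1 = ℕ.pred (exponent G)

  suc[exponent-1]≡exponent : suc exponent-1 ≡ exponent G
  suc[exponent-1]≡exponent = ℕP.suc-pred (exponent G) {{lcmOfOrders-nonZero enum}}

  φ*ord≡exponent : ∀ g → φ G g ℕ.* ord G g ≡ suc exponent-1
  φ*ord≡exponent g = ≡.trans (m/n*n≡m (ord∣exponent g)) (≡.sym suc[exponent-1]≡exponent)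

  crossNumber≃voltage/exponent : ∀ {k} (β : Vec Carrier k) →
    toℚᵘ (crossNumber G β) ≃ mkℚᵘ (+ voltageProduct G β) exponent-1
  crossNumber≃voltage/exponent []      = *≡* refl
  crossNumber≃voltage/exponent (g ∷ β) = begin
    toℚᵘ ((+ 1 ℚ./ ord G g) ℚ.+ crossNumber G β)
      ≈⟨ ℚP.toℚᵘ-homo-+ (+ 1 ℚ./ ord G g) (crossNumber G β) ⟩
    toℚᵘ (+ 1 ℚ./ ord G g) ℚᵘ.+ toℚᵘ (crossNumber G β)
      ≈⟨ ℚᵘP.+-cong (ℚP.toℚᵘ-fromℚᵘ (mkℚᵘ (+ 1) (ℕ.pred (ord G g)))) (crossNumber≃voltage/exponent β) ⟩
    mkℚᵘ (+ 1) (ℕ.pred (ord G g)) ℚᵘ.+ mkℚᵘ (+ voltageProduct G β) exponent-1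
      ≈⟨ unitFraction+≃ (φ G g) (voltageProduct G β) _ exponent-1 (φ*ord≡exponent g) ⟩
    mkℚᵘ (+ voltageProduct G (g ∷ β)) exponent-1 ∎
    where open ℚᵘP.≃-Reasoning

  crossNumber-integral⇔exponent∣voltage : ∀ {k} (β : Vec Carrier k) →
    IsIntegerℚ G (crossNumber G β) ⇔ exponent G ∣ voltageProduct G β
  crossNumber-integral⇔exponent∣voltage β =
    ≡.subst (λ N → IsIntegerℚ G (crossNumber G β) ⇔ N ∣ voltageProduct G β) suc[exponent-1]≡exponent
      (integer⇔∣ (crossNumber G β) (voltageProduct G β) exponent-1 (crossNumber≃voltage/exponent β))

  voltageProduct-split : ∀ {k} (β : Vec Carrier k) ms →
    voltageProduct G β ≡ voltageProduct G (select β ms) ℕ.+ voltageProduct G (reject β ms)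
  voltageProduct-split []      []           = refl
  voltageProduct-split (g ∷ β) (true  ∷ ms) =
    ≡.trans (cong (φ G g ℕ.+_) (voltageProduct-split β ms)) (≡.sym (ℕP.+-assoc (φ G g) _ _))
  voltageProduct-split (g ∷ β) (false ∷ ms) =
    ≡.trans (cong (φ G g ℕ.+_) (voltageProduct-split β ms))
            (ℕ+.x∙yz≈y∙xz (φ G g) (voltageProduct G (select β ms)) (voltageProduct G (reject β ms)))

  prod-select : ∀ {k} (β : Vec Carrier k) ms → prod G (select β ms) ≡ prodSel G β ms
  prod-select []      []           = refl
  prod-select (g ∷ β) (true  ∷ ms) = cong (g ∙_) (prod-select β ms)
  prod-select (g ∷ β) (false ∷ ms) = prod-select β ms

  prod≈prodSel∙prod-reject : ∀ {k} (β : Vec Carrier k) ms →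
    prod G β ≈ prodSel G β ms ∙ prod G (reject β ms)
  prod≈prodSel∙prod-reject []      []           = sym (identityˡ ε)
  prod≈prodSel∙prod-reject (g ∷ β) (true  ∷ ms) =
    trans (∙-cong ≈-refl (prod≈prodSel∙prod-reject β ms)) (sym (assoc _ _ _))
  prod≈prodSel∙prod-reject (g ∷ β) (false ∷ ms) =
    trans (∙-cong ≈-refl (prod≈prodSel∙prod-reject β ms)) (x∙yz≈y∙xz g _ _)

  ProperZeroSum : ∀ {k} → Vec Carrier k → Vec Bool k → Set ℓ
  ProperZeroSum β ms = prodSel G β ms ≈ ε × ¬ allOnes G ms × ¬ allZeros G ms

  properZeroSum? : ∀ {k} (β : Vec Carrier k) → Decidable (ProperZeroSum β)
  properZeroSum? β ms =
    (prodSel G β ms ≟ ε) ×-dec ¬? (All.all? (Bool._≟ true) ms) ×-dec ¬? (All.all? (Bool._≟ false) ms)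

  atom⊎properZeroSum : ∀ {k} {β : Vec Carrier k} → IsBlock G β → IsAtom G β ⊎ ∃ (ProperZeroSum β)
  atom⊎properZeroSum {β = β} block with anySubset? (properZeroSum? β)
  ... | yes found = inj₂ found
  ... | no  none  = inj₁ (block , trivial)
    where
    trivial : ∀ ms → prodSel G β ms ≈ ε → allOnes G ms ⊎ allZeros G ms
    trivial ms zeroSum with All.all? (Bool._≟ true) ms | All.all? (Bool._≟ false) ms
    ... | yes ones    | _           = inj₁ ones
    ... | no  _       | yes zeros   = inj₂ zeros
    ... | no  notOnes | no notZeros = ⊥-elim (none (ms , zeroSum , notOnes , notZeros))

  IsBlock-select : ∀ {k} {β : Vec Carrier k} ms → IsBlock G β → prodSel G β ms ≈ ε → IsBlock G (select β ms)
  IsBlock-select {β = β} ms (nonTrivial , _) zeroSum =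
    All-select ms nonTrivial , trans (reflexive (prod-select β ms)) zeroSum

  IsBlock-reject : ∀ {k} {β : Vec Carrier k} ms → IsBlock G β → prodSel G β ms ≈ ε → IsBlock G (reject β ms)
  IsBlock-reject {β = β} ms (nonTrivial , β≈ε) zeroSum = All-reject ms nonTrivial , (begin
    prod G (reject β ms)                   ≈⟨ identityˡ _ ⟨
    ε ∙ prod G (reject β ms)               ≈⟨ ∙-cong zeroSum ≈-refl ⟨
    prodSel G β ms ∙ prod G (reject β ms)  ≈⟨ prod≈prodSel∙prod-reject β ms ⟨
    prod G β                               ≈⟨ β≈ε ⟩
    ε                                      ∎)
    where open ≈-Reasoning setoid

  weaklyHalfFactorial⇒exponent∣voltage : ∀ {p} {S : Pred Carrier p} → WeaklyHalfFactorial G S →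
    ∀ {k} {β : Vec Carrier k} → All S β → IsBlock G β → exponent G ∣ voltageProduct G β
  weaklyHalfFactorial⇒exponent∣voltage {S = S} whf {k} {β} = <-rec Motive step k β
    where
    Motive : ℕ → Set _
    Motive k = ∀ (β : Vec Carrier k) → All S β → IsBlock G β → exponent G ∣ voltageProduct G β
    step : ∀ k → (∀ {j} → j < k → Motive j) → Motive k
    step k rec β S-β block with atom⊎properZeroSum block
    ... | inj₁ atom = Equivalence.to (crossNumber-integral⇔exponent∣voltage β) (whf β S-β atom)
    ... | inj₂ (ms , zeroSum , notOnes , notZeros) =
      ≡.subst (exponent G ∣_) (≡.sym (voltageProduct-split β ms)) (∣m∣n⇒∣m+n
        (rec (countTrue< ms notOnes) (select β ms) (All-select ms S-β) (IsBlock-select ms block zeroSum))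
        (rec (countFalse< ms notZeros) (reject β ms) (All-reject ms S-β) (IsBlock-reject ms block zeroSum)))

  last-vertices : ∀ {k} x (ss : Vec Carrier k) → last (vertices G x ss) ≈ x ∙ prod G ss
  last-vertices x []       = sym (identityʳ x)
  last-vertices x (s ∷ ss) = trans (last-vertices (x ∙ s) ss) (assoc x s (prod G ss))

  lookup-vertices-zero : ∀ {k} x (ss : Vec Carrier k) → lookup (vertices G x ss) Fin.zero ≡ x
  lookup-vertices-zero x []      = refl
  lookup-vertices-zero x (_ ∷ _) = refl

  prodSel-emptySegment : ∀ {k} (ss : Vec Carrier k) → prodSel G ss (segment k 0 0) ≈ ε
  prodSel-emptySegment []       = ≈-refl
  prodSel-emptySegment (_ ∷ ss) = prodSel-emptySegment ss

  lookup-vertices-segment : ∀ {k} x (ss : Vec Carrier k) (i j : Fin (suc k)) → toℕ i ≤ toℕ j →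
    lookup (vertices G x ss) j ≈ lookup (vertices G x ss) i ∙ prodSel G ss (segment k (toℕ i) (toℕ j))
  lookup-vertices-segment x []       Fin.zero    Fin.zero    _ = sym (identityʳ x)
  lookup-vertices-segment x (s ∷ ss) Fin.zero    Fin.zero    _ =
    sym (trans (∙-cong ≈-refl (prodSel-emptySegment ss)) (identityʳ x))
  lookup-vertices-segment x (s ∷ ss) Fin.zero    (Fin.suc j) _ = begin
    lookup (vertices G (x ∙ s) ss) j            ≈⟨ lookup-vertices-segment (x ∙ s) ss Fin.zero j z≤n ⟩
    lookup (vertices G (x ∙ s) ss) Fin.zero ∙ P ≈⟨ ∙-cong (reflexive (lookup-vertices-zero (x ∙ s) ss)) ≈-refl ⟩
    (x ∙ s) ∙ P                                 ≈⟨ assoc x s P ⟩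
    x ∙ (s ∙ P)                                 ∎
    where
    open ≈-Reasoning setoid
    P = prodSel G ss (segment _ 0 (toℕ j))
  lookup-vertices-segment x (s ∷ ss) (Fin.suc i) (Fin.suc j) (s≤s i≤j) =
    lookup-vertices-segment (x ∙ s) ss i j i≤j

  closedPath⇒block : ∀ {p} {S : Pred Carrier p} → (∀ s → S s → ¬ s ≈ ε) →
    ∀ {k} {x} {ss : Vec Carrier (suc k)} → All S ss → IsClosedPath G x ss → IsBlock G ss
  closedPath⇒block S∌ε {x = x} {ss = ss@(_ ∷ _)} S-ss (_ , x≈last) =
    All.map (λ {s} → S∌ε s) S-ss , identityʳ-unique x (prod G ss) (sym (trans x≈last (last-vertices x ss)))

  -- A repeated vertex x_i ≈ x_j makes the segment i ≤ p < j a zero-sum subsequence.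
  atom⇒closedPath : ∀ {k} {β : Vec Carrier (suc k)} → IsAtom G β → IsClosedPath G ε β
  atom⇒closedPath {k} {β@(_ ∷ _)} ((_ , β≈ε) , atomic) =
    distinct , sym (trans (last-vertices ε β) (trans (identityˡ (prod G β)) β≈ε))
    where
    distinct : ∀ (i j : Fin (suc (suc k))) → toℕ i < toℕ j → ¬ (toℕ i ≡ 0 × toℕ j ≡ suc k) →
               ¬ (lookup (vertices G ε β) i ≈ lookup (vertices G ε β) j)
    distinct i j i<j notEnds xᵢ≈xⱼ
      with atomic (segment (suc k) (toℕ i) (toℕ j))
                  (identityʳ-unique _ _ (sym (trans xᵢ≈xⱼ (lookup-vertices-segment ε β i j (ℕP.<⇒≤ i<j)))))
    ... | inj₂ zeros = segment-notAllFalse (suc k) (toℕ i) (toℕ j) i<j (FinP.toℕ≤pred[n] j) zeros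
    ... | inj₁ ones with segment-allTrue k (toℕ i) (toℕ j) ones
    ...   | i≡0 , k<j = notEnds (i≡0 , ℕP.≤-antisym (FinP.toℕ≤pred[n] j) k<j)

theorem2 : ∀ {c ℓ p} (G : FiniteAbelianGroup c ℓ) (S : Pred (FiniteAbelianGroup.Carrier G) p) →
    (∀ s → S s → ¬ (FiniteAbelianGroup._≈_ G s (FiniteAbelianGroup.ε G))) →
    WeaklyHalfFactorial G S ⇔ KVL G S
theorem2 G S S∌ε = mk⇔ whf⇒kvl kvl⇒whf
  where
  open FiniteAbelianGroup G using (ε)
  whf⇒kvl : WeaklyHalfFactorial G S → KVL G S
  whf⇒kvl whf x ss S-ss path =
    weaklyHalfFactorial⇒exponent∣voltage G whf S-ss (closedPath⇒block G S∌ε S-ss path)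
  kvl⇒whf : KVL G S → WeaklyHalfFactorial G S
  kvl⇒whf kvl {zero}  [] _   _    = Equivalence.from (crossNumber-integral⇔exponent∣voltage G []) (exponent G ∣0)
  kvl⇒whf kvl {suc k} β  S-β atom =
    Equivalence.from (crossNumber-integral⇔exponent∣voltage G β) (kvl ε β S-β (atom⇒closedPath G atom))
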